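{- Let $G$ be a balanced bipartite graph on $n$ vertices with bipartition $\{V_1,V_2\}$ which has no path of length $k$. Then there exist $X_1\subseteq V_1$ and $X_2\subseteq V_2$ such that $|X_1|=|X_2|\ge (n-k)/4$ and $G$ has no edges between $X_1$ and $X_2$.
   Context: A bipartite graph with bipartition $\{V_1,V_2\}$ is balanced if $|V_1|=|V_2|$. The length of a path is its number of edges. -}

module Defs where

open import Data.Nat using (ℕ; suc)
open import Data.Fin using (Fin; inject₁) renaming (suc to fsuc)
open import Data.Fin.Subset using (Subset; _∈_)
open import Data.Bool using (Bool; true)
open import Data.Sum using (_⊎_; inj₁; inj₂)
open import Data.Product using (Σ; _×_)
open import Data.Empty using (⊥)
open import Relation.Binary.PropositionalEquality using (_≡_)
open import Relation.Nullary using (¬_)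
open import Function.Definitions using (Injective)

-- A (finite, simple) balanced bipartite graph with parts V₁ = V₂ = Fin m,
-- given by its bipartite adjacency: E i j = true iff i ∈ V₁ and j ∈ V₂ are adjacent.
record BipGraph (m : ℕ) : Set where
  field
    E : Fin m → Fin m → Bool

Vertex : ℕ → Set
Vertex m = Fin m ⊎ Fin m

Adj : ∀ {m} → BipGraph m → Vertex m → Vertex m → Set
Adj G (inj₁ i) (inj₂ j) = BipGraph.E G i j ≡ true
Adj G (inj₂ j) (inj₁ i) = BipGraph.E G i j ≡ true
Adj G (inj₁ _) (inj₁ _) = ⊥
Adj G (inj₂ _) (inj₂ _) = ⊥

-- a path of length k (k edges): k+1 pairwise distinct vertices, consecutive ones adjacent
record Path {m : ℕ} (G : BipGraph m) (k : ℕ) : Set where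
  field
    vtx      : Fin (suc k) → Vertex m
    distinct : Injective _≡_ _≡_ vtx
    adjacent : ∀ (i : Fin k) → Adj G (vtx (inject₁ i)) (vtx (fsuc i))

NoEdgesBetween : ∀ {m} → BipGraph m → Subset m → Subset m → Set
NoEdgesBetween G X₁ X₂ = ∀ i j → i ∈ X₁ → j ∈ X₂ → ¬ (BipGraph.E G i j ≡ true)

-- Run a depth-first search in G, recording the finished vertices S, the stack T and the
-- unvisited vertices U, each split along the parts V₁, V₂. There is never an edge between S and
-- U, and the stack is a path. A vertex whose push would bring the stack to k vertices has no
-- unvisited neighbour (that would be a path of length k), so it is finished at once; hence the
-- stack keeps fewer than k vertices, and as it alternates between the parts each part holds at
-- most k/2 of them. Every step lowers |U₂| - |S₁| and |U₁| - |S₂| by at most one, so at some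
-- point |S₁| = |U₂| = s (or symmetrically). Either 4s + k ≥ n and (S₁, U₂) will do, or U₁ and
-- S₂ both have at least m - s - k/2 > (n - k)/4 vertices and (U₁, S₂) will do.

module Submission where

open import Defs
open import Data.Bool using (true)
open import Data.Bool.Properties using () renaming (_≟_ to _≟ᵇ_)
open import Data.Empty using (⊥-elim)
open import Data.Fin using (Fin; zero; suc; inject₁)
open import Data.Fin.Properties using (any?)
open import Data.Fin.Subset
  using (Subset; _∈_; _∉_; _⊆_; ∣_∣; inside; outside; ⁅_⁆; _∪_; _-_; Nonempty)
  renaming (⊥ to ∅; ⊤ to full)
open import Data.Fin.Subset.Properties
  using ( _∈?_; ∉⊥; ⊥⊆; ∣⊥∣≡0; ∣⊤∣≡n; nonempty?; Empty-unique; in⊆in; s⊆s; p⊆q⇒∣p∣≤∣q∣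
        ; ∪-identityʳ; p─⊥≡p; p─q⊆p; x∈p∪q⁻; x∈⁅y⁆⇒x≡y)
open import Data.List using (List; []; _∷_; length; lookup; map)
open import Data.List.Properties using (length-map)
open import Data.List.Membership.Propositional.Properties using (∈-lookup)
open import Data.List.Relation.Unary.All as All using (All; []; _∷_)
import Data.List.Relation.Unary.All.Properties as All
open import Data.List.Relation.Unary.AllPairs as AllPairs using ([]; _∷_)
open import Data.List.Relation.Unary.Linked as Linked using (Linked; []; [-]; _∷_)
import Data.List.Relation.Unary.Linked.Properties as Linked
open import Data.List.Relation.Unary.Unique.Propositional using (Unique)
import Data.List.Relation.Unary.Unique.Propositional.Properties as Unique
open import Data.Nat using (ℕ; zero; suc; _+_; _*_; _≤_; _<_; z≤n; s≤s; s≤s⁻¹; _≤?_)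
open import Data.Nat.Properties
open import Data.Nat.Tactic.RingSolver using (solve-∀)
open import Data.Product using (Σ-syntax; ∃-syntax; _×_; _,_; proj₁; proj₂)
import Data.Product as Product
open import Data.Sum using (_⊎_; inj₁; inj₂; swap; [_,_]′)
import Data.Sum as Sum
open import Data.Sum.Properties using (swap-involutive)
open import Data.Vec.Base using (_∷_; here; there)
open import Function using (_∘_; flip)
open import Relation.Binary.PropositionalEquality
open import Relation.Nullary using (¬_; Dec; yes; no; contradiction)
open import Relation.Nullary.Decidable using (_×-dec_)

∣p∪⁅x⁆∣≡1+∣p∣ : ∀ {n} {p : Subset n} {x} → x ∉ p → ∣ p ∪ ⁅ x ⁆ ∣ ≡ suc ∣ p ∣
∣p∪⁅x⁆∣≡1+∣p∣ {p = outside ∷ p} {zero}  _   = cong (suc ∘ ∣_∣) (∪-identityʳ p)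
∣p∪⁅x⁆∣≡1+∣p∣ {p = inside  ∷ p} {zero}  x∉p = contradiction here x∉p
∣p∪⁅x⁆∣≡1+∣p∣ {p = outside ∷ p} {suc x} x∉p = ∣p∪⁅x⁆∣≡1+∣p∣ (x∉p ∘ there)
∣p∪⁅x⁆∣≡1+∣p∣ {p = inside  ∷ p} {suc x} x∉p = cong suc (∣p∪⁅x⁆∣≡1+∣p∣ (x∉p ∘ there))

1+∣p-x∣≡∣p∣ : ∀ {n} {p : Subset n} {x} → x ∈ p → suc ∣ p - x ∣ ≡ ∣ p ∣
1+∣p-x∣≡∣p∣ {p = inside  ∷ p} {zero}  here        = cong (suc ∘ ∣_∣) (p─⊥≡p p)
1+∣p-x∣≡∣p∣ {p = outside ∷ p} {suc x} (there x∈p) = 1+∣p-x∣≡∣p∣ x∈p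
1+∣p-x∣≡∣p∣ {p = inside  ∷ p} {suc x} (there x∈p) = cong suc (1+∣p-x∣≡∣p∣ x∈p)

x∉p-x : ∀ {n} {p : Subset n} {x} → x ∉ p - x
x∉p-x {p = _ ∷ _} {zero}  ()
x∉p-x {p = _ ∷ _} {suc x} (there x∈p-x) = x∉p-x x∈p-x

0<∣p∣⇒Nonempty : ∀ {n} {p : Subset n} → 0 < ∣ p ∣ → Nonempty p
0<∣p∣⇒Nonempty {n} {p} 0<∣p∣ with nonempty? p
... | yes nonempty = nonempty
... | no  empty    = contradiction (trans (cong ∣_∣ (Empty-unique empty)) (∣⊥∣≡0 n)) (>⇒≢ 0<∣p∣)

x∈p∪⁅y⁆⁻ : ∀ {n} {p : Subset n} {x y} → x ∈ p ∪ ⁅ y ⁆ → x ∈ p ⊎ x ≡ y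
x∈p∪⁅y⁆⁻ {p = p} {y = y} = Sum.map₂ (x∈⁅y⁆⇒x≡y y) ∘ x∈p∪q⁻ p ⁅ y ⁆

⊆-ofSize : ∀ {n} (p : Subset n) {c} → c ≤ ∣ p ∣ → Σ[ q ∈ Subset n ] q ⊆ p × ∣ q ∣ ≡ c
⊆-ofSize {n} p {zero} _ = ∅ , ⊥⊆ , ∣⊥∣≡0 n
⊆-ofSize (inside ∷ p) {suc c} (s≤s c≤∣p∣) =
  let q , q⊆p , ∣q∣≡c = ⊆-ofSize p c≤∣p∣ in inside ∷ q , in⊆in q⊆p , cong suc ∣q∣≡c
⊆-ofSize (outside ∷ p) {suc c} c<∣p∣ =
  let q , q⊆p , ∣q∣≡c = ⊆-ofSize p c<∣p∣ in outside ∷ q , s⊆s q⊆p , ∣q∣≡c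

lookup-injective : ∀ {A : Set} {xs : List A} → Unique xs →
                   ∀ {i j} → lookup xs i ≡ lookup xs j → i ≡ j
lookup-injective (_   ∷ u) {zero}  {zero}  _ = refl
lookup-injective (x∉xs ∷ _) {zero}  {suc j} e = contradiction e (All.lookup x∉xs (∈-lookup j))
lookup-injective (x∉xs ∷ _) {suc i} {zero}  e = contradiction (sym e) (All.lookup x∉xs (∈-lookup i))
lookup-injective (_   ∷ u) {suc i} {suc j} e = cong suc (lookup-injective u e)

Linked-lookup : ∀ {A : Set} {R : A → A → Set} {x xs} → Linked R (x ∷ xs) →
                (i : Fin (length xs)) → R (lookup (x ∷ xs) (inject₁ i)) (lookup (x ∷ xs) (suc i))
Linked-lookup (r ∷ _)  zero    = r
Linked-lookup (_ ∷ rs) (suc i) = Linked-lookup rs i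

swap-injective : ∀ {A B : Set} {u v : A ⊎ B} → swap u ≡ swap v → u ≡ v
swap-injective {u = u} {v} e =
  trans (sym (swap-involutive u)) (trans (cong swap e) (swap-involutive v))

remainder-large : ∀ {s t c m k} → s + t + c ≡ m → t + t ≤ k → 4 * s + k < m + m → m + m ≤ 4 * c + k
remainder-large {s} {t} {c} {k = k} refl 2t≤k small =
  <⇒≤ (+-cancelʳ-< k L (4 * c + k) (+-cancelˡ-< L (L + k) (4 * c + k + k) (begin-strict
    L + (L + k)                               ≡⟨ regroup s t c k ⟩
    (4 * s + k) + (4 * c + (t + t) + (t + t)) <⟨ +-monoˡ-< (4 * c + (t + t) + (t + t)) small ⟩
    L + (4 * c + (t + t) + (t + t))           ≤⟨ +-monoʳ-≤ L (+-mono-≤ (+-monoʳ-≤ (4 * c) 2t≤k) 2t≤k) ⟩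
    L + (4 * c + k + k)                       ∎)))
  where
  open ≤-Reasoning
  L : ℕ
  L = s + t + c + (s + t + c)
  regroup : ∀ s t c k → s + t + c + (s + t + c) + (s + t + c + (s + t + c) + k) ≡
                         (4 * s + k) + (4 * c + (t + t) + (t + t))
  regroup = solve-∀

module _ {m : ℕ} where

  _ᵀ : BipGraph m → BipGraph m
  G ᵀ = record { E = flip (BipGraph.E G) }

  Adj-ᵀ : ∀ {G : BipGraph m} {u v} → Adj G u v → Adj (G ᵀ) (swap u) (swap v)
  Adj-ᵀ {u = inj₁ _} {inj₂ _} e = e
  Adj-ᵀ {u = inj₂ _} {inj₁ _} e = e

  Path-ᵀ : ∀ {G : BipGraph m} {k} → Path (G ᵀ) k → Path G k
  Path-ᵀ P = record
    { vtx      = swap ∘ vtx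
    ; distinct = distinct ∘ swap-injective
    ; adjacent = Adj-ᵀ ∘ adjacent
    }
    where open Path P

  Linked∧Unique⇒Path : ∀ {G : BipGraph m} {v L} →
                       Linked (Adj G) (v ∷ L) → Unique (v ∷ L) → Path G (length L)
  Linked∧Unique⇒Path {v = v} {L} linked unique = record
    { vtx      = lookup (v ∷ L)
    ; distinct = lookup-injective unique
    ; adjacent = Linked-lookup linked
    }

  ∣_∣₁ ∣_∣₂ : List (Vertex m) → ℕ
  ∣ []         ∣₁ = 0
  ∣ inj₁ _ ∷ T ∣₁ = suc ∣ T ∣₁
  ∣ inj₂ _ ∷ T ∣₁ = ∣ T ∣₁
  ∣ []         ∣₂ = 0
  ∣ inj₁ _ ∷ T ∣₂ = ∣ T ∣₂
  ∣ inj₂ _ ∷ T ∣₂ = suc ∣ T ∣₂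

  ∣T∣₁+∣T∣₂≡length : ∀ T → ∣ T ∣₁ + ∣ T ∣₂ ≡ length T
  ∣T∣₁+∣T∣₂≡length []           = refl
  ∣T∣₁+∣T∣₂≡length (inj₁ _ ∷ T) = cong suc (∣T∣₁+∣T∣₂≡length T)
  ∣T∣₁+∣T∣₂≡length (inj₂ _ ∷ T) = trans (+-suc ∣ T ∣₁ ∣ T ∣₂) (cong suc (∣T∣₁+∣T∣₂≡length T))

  ∣map-swap∣₁ : ∀ T → ∣ map swap T ∣₁ ≡ ∣ T ∣₂
  ∣map-swap∣₁ []           = refl
  ∣map-swap∣₁ (inj₁ _ ∷ T) = ∣map-swap∣₁ T
  ∣map-swap∣₁ (inj₂ _ ∷ T) = cong suc (∣map-swap∣₁ T)

  ∣map-swap∣₂ : ∀ T → ∣ map swap T ∣₂ ≡ ∣ T ∣₁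
  ∣map-swap∣₂ []           = refl
  ∣map-swap∣₂ (inj₁ _ ∷ T) = cong suc (∣map-swap∣₂ T)
  ∣map-swap∣₂ (inj₂ _ ∷ T) = ∣map-swap∣₂ T

  sides-alternate : ∀ {G : BipGraph m} {T} → Linked (Adj G) T →
                    ∣ T ∣₁ ≤ suc ∣ T ∣₂ × ∣ T ∣₂ ≤ suc ∣ T ∣₁
  sides-alternate []                                 = z≤n , z≤n
  sides-alternate {T = inj₁ _ ∷ []}          [-]     = s≤s z≤n , z≤n
  sides-alternate {T = inj₂ _ ∷ []}          [-]     = z≤n , s≤s z≤n
  sides-alternate {T = inj₁ _ ∷ inj₂ _ ∷ _} (_ ∷ l) = Product.map s≤s s≤s (sides-alternate (Linked.tail l))
  sides-alternate {T = inj₂ _ ∷ inj₁ _ ∷ _} (_ ∷ l) = Product.map s≤s s≤s (sides-alternate (Linked.tail l))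
  sides-alternate {T = inj₁ _ ∷ inj₁ _ ∷ _} (() ∷ _)
  sides-alternate {T = inj₂ _ ∷ inj₂ _ ∷ _} (() ∷ _)

  sides-≤-half : ∀ {G : BipGraph m} {T k} → Linked (Adj G) T → length T < k →
                 ∣ T ∣₁ + ∣ T ∣₁ ≤ k × ∣ T ∣₂ + ∣ T ∣₂ ≤ k
  sides-≤-half {T = T} linked short =
      half (proj₁ alternate) (subst (_< _) (sym ∣T∣≡length) short)
    , half (proj₂ alternate) (subst (_< _) (sym (trans (+-comm ∣ T ∣₂ ∣ T ∣₁) ∣T∣≡length)) short)
    where
    alternate = sides-alternate linked
    ∣T∣≡length = ∣T∣₁+∣T∣₂≡length T
    half : ∀ {a b k} → a ≤ suc b → a + b < k → a + a ≤ k
    half {a} {b} {k} a≤1+b a+b<k =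
      ≤-trans (+-monoʳ-≤ a a≤1+b) (subst (_≤ k) (sym (+-suc a b)) a+b<k)

  LargeBiHole : BipGraph m → ℕ → Set
  LargeBiHole G k = Σ[ X₁ ∈ Subset m ] Σ[ X₂ ∈ Subset m ]
    (∣ X₁ ∣ ≡ ∣ X₂ ∣ × m + m ≤ 4 * ∣ X₁ ∣ + k × NoEdgesBetween G X₁ X₂)

  LargeBiHole-ᵀ : ∀ {G : BipGraph m} {k} → LargeBiHole (G ᵀ) k → LargeBiHole G k
  LargeBiHole-ᵀ {k = k} (X₁ , X₂ , ∣X₁∣≡∣X₂∣ , large , noEdges) =
    X₂ , X₁ , sym ∣X₁∣≡∣X₂∣ , subst (λ c → m + m ≤ 4 * c + k) ∣X₁∣≡∣X₂∣ large ,
    λ i j i∈X₂ j∈X₁ → noEdges j i j∈X₁ i∈X₂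

  NoEdgesBetween⇒LargeBiHole : ∀ {G : BipGraph m} {k A B} → NoEdgesBetween G A B →
                               m + m ≤ 4 * ∣ A ∣ + k → m + m ≤ 4 * ∣ B ∣ + k → LargeBiHole G k
  NoEdgesBetween⇒LargeBiHole {A = A} {B} noEdges largeA largeB with ≤-total ∣ A ∣ ∣ B ∣
  ... | inj₁ ∣A∣≤∣B∣ = let B′ , B′⊆B , ∣B′∣≡∣A∣ = ⊆-ofSize B ∣A∣≤∣B∣ in
    A , B′ , sym ∣B′∣≡∣A∣ , largeA , λ i j i∈A j∈B′ → noEdges i j i∈A (B′⊆B j∈B′)
  ... | inj₂ ∣B∣≤∣A∣ = let A′ , A′⊆A , ∣A′∣≡∣B∣ = ⊆-ofSize A ∣B∣≤∣A∣ in
    A′ , B , ∣A′∣≡∣B∣ , subst (λ c → m + m ≤ 4 * c + _) (sym ∣A′∣≡∣B∣) largeB ,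
    λ i j i∈A′ j∈B → noEdges i j (A′⊆A i∈A′) j∈B

-- Depth-first search

module DFS {m : ℕ} (k : ℕ) where

  -- S: finished vertices, T: the stack with its top first, U: unvisited vertices;
  -- the index is the part.
  record State : Set where
    constructor state
    field
      S₁ S₂ U₁ U₂ : Subset m
      T           : List (Vertex m)

  open State

  -- Each step is only written for one part; its mirror image is obtained by transposing.
  transpose : State → State
  transpose (state S₁ S₂ U₁ U₂ T) = state S₂ S₁ U₂ U₁ (map swap T)

  Fresh : State → Vertex m → Set
  Fresh st (inj₁ i) = i ∉ S₁ st × i ∉ U₁ st
  Fresh st (inj₂ j) = j ∉ S₂ st × j ∉ U₂ st

  Unvisited : State → Vertex m → Set
  Unvisited st (inj₁ i) = i ∈ U₁ st
  Unvisited st (inj₂ j) = j ∈ U₂ st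

  unvisited-fresh : ∀ {st u v} → Unvisited st u → Fresh st v → u ≢ v
  unvisited-fresh {u = inj₁ _} {inj₁ _} u∈U (_ , u∉U) refl = u∉U u∈U
  unvisited-fresh {u = inj₂ _} {inj₂ _} u∈U (_ , u∉U) refl = u∉U u∈U
  unvisited-fresh {u = inj₁ _} {inj₂ _} _ _ ()
  unvisited-fresh {u = inj₂ _} {inj₁ _} _ _ ()

  record Invariant (H : BipGraph m) (st : State) : Set where
    field
      separated₁ : NoEdgesBetween H (S₁ st) (U₂ st)
      separated₂ : NoEdgesBetween H (U₁ st) (S₂ st)
      size₁      : ∣ S₁ st ∣ + ∣ T st ∣₁ + ∣ U₁ st ∣ ≡ m
      size₂      : ∣ S₂ st ∣ + ∣ T st ∣₂ + ∣ U₂ st ∣ ≡ m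
      disjoint₁  : ∀ {i} → i ∈ S₁ st → i ∉ U₁ st
      disjoint₂  : ∀ {j} → j ∈ S₂ st → j ∉ U₂ st
      fresh      : All (Fresh st) (T st)
      path       : Linked (Adj H) (T st)
      unique     : Unique (T st)

  record Live (H : BipGraph m) (st : State) : Set where
    field
      invariant : Invariant H st
      short     : length (T st) < k
      balanced₁ : ∣ S₁ st ∣ ≤ ∣ U₂ st ∣
      balanced₂ : ∣ S₂ st ∣ ≤ ∣ U₁ st ∣

  Invariant-ᵀ : ∀ {H st} → Invariant H st → Invariant (H ᵀ) (transpose st)
  Invariant-ᵀ {st = st} I = record
    { separated₁ = λ i j i∈S₂ j∈U₁ → separated₂ j i j∈U₁ i∈S₂
    ; separated₂ = λ i j i∈U₂ j∈S₁ → separated₁ j i j∈S₁ i∈U₂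
    ; size₁      = trans (cong (λ t → ∣ S₂ st ∣ + t + ∣ U₂ st ∣) (∣map-swap∣₁ (T st))) size₂
    ; size₂      = trans (cong (λ t → ∣ S₁ st ∣ + t + ∣ U₁ st ∣) (∣map-swap∣₂ (T st))) size₁
    ; disjoint₁  = disjoint₂
    ; disjoint₂  = disjoint₁
    ; fresh      = All.map⁺ (All.map Fresh-swap fresh)
    ; path       = Linked.map⁺ (Linked.map Adj-ᵀ path)
    ; unique     = Unique.map⁺ swap-injective unique
    }
    where
    open Invariant I
    Fresh-swap : ∀ {v} → Fresh st v → Fresh (transpose st) (swap v)
    Fresh-swap {inj₁ _} f = f
    Fresh-swap {inj₂ _} f = f

  Live-ᵀ : ∀ {H st} → Live H st → Live (H ᵀ) (transpose st)
  Live-ᵀ {st = st} L = record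
    { invariant = Invariant-ᵀ invariant
    ; short     = subst (_< k) (sym (length-map swap (T st))) short
    ; balanced₁ = balanced₂
    ; balanced₂ = balanced₁
    }
    where open Live L

  pop₁ : ∀ {H S₁ S₂ U₁ U₂ i T} → Invariant H (state S₁ S₂ U₁ U₂ (inj₁ i ∷ T)) →
         (∀ j → j ∈ U₂ → ¬ BipGraph.E H i j ≡ true) →
         Invariant H (state (S₁ ∪ ⁅ i ⁆) S₂ U₁ U₂ T)
  pop₁ {H} {S₁} {S₂} {U₁} {U₂} {i} {T} I isolated = record
    { separated₁ = λ i′ j i′∈ j∈U₂ →
        [ (λ i′∈S₁ → separated₁ i′ j i′∈S₁ j∈U₂) , (λ { refl → isolated j j∈U₂ }) ]′ (x∈p∪⁅y⁆⁻ i′∈)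
    ; separated₂ = separated₂
    ; size₁      = begin
        ∣ S₁ ∪ ⁅ i ⁆ ∣ + ∣ T ∣₁ + ∣ U₁ ∣ ≡⟨ cong (λ s → s + ∣ T ∣₁ + ∣ U₁ ∣) (∣p∪⁅x⁆∣≡1+∣p∣ i∉S₁) ⟩
        suc ∣ S₁ ∣ + ∣ T ∣₁ + ∣ U₁ ∣    ≡⟨ cong (_+ ∣ U₁ ∣) (+-suc ∣ S₁ ∣ ∣ T ∣₁) ⟨
        ∣ S₁ ∣ + suc ∣ T ∣₁ + ∣ U₁ ∣    ≡⟨ size₁ ⟩
        m                               ∎
    ; size₂      = size₂
    ; disjoint₁  = λ i′∈ → [ disjoint₁ , (λ { refl → i∉U₁ }) ]′ (x∈p∪⁅y⁆⁻ i′∈)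
    ; disjoint₂  = disjoint₂
    ; fresh      = All.zipWith Fresh-pop (AllPairs.head unique , All.tail fresh)
    ; path       = Linked.tail path
    ; unique     = AllPairs.tail unique
    }
    where
    open Invariant I
    open ≡-Reasoning
    i∉S₁ = proj₁ (All.head fresh)
    i∉U₁ = proj₂ (All.head fresh)
    Fresh-pop : ∀ {v} → inj₁ i ≢ v × Fresh (state S₁ S₂ U₁ U₂ (inj₁ i ∷ T)) v →
                Fresh (state (S₁ ∪ ⁅ i ⁆) S₂ U₁ U₂ T) v
    Fresh-pop {inj₁ i′} (i≢i′ , i′∉S₁ , i′∉U₁) =
      [ i′∉S₁ , (λ { refl → i≢i′ refl }) ]′ ∘ x∈p∪⁅y⁆⁻ , i′∉U₁
    Fresh-pop {inj₂ _} (_ , f) = f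

  push₂ : ∀ {H S₁ S₂ U₁ U₂ j T} → Invariant H (state S₁ S₂ U₁ U₂ T) → j ∈ U₂ →
          Linked (Adj H) (inj₂ j ∷ T) → Invariant H (state S₁ S₂ U₁ (U₂ - j) (inj₂ j ∷ T))
  push₂ {H} {S₁} {S₂} {U₁} {U₂} {j} {T} I j∈U₂ linked = record
    { separated₁ = λ i j′ i∈S₁ j′∈ → separated₁ i j′ i∈S₁ (U₂-j⊆U₂ j′∈)
    ; separated₂ = separated₂
    ; size₁      = size₁
    ; size₂      = begin
        ∣ S₂ ∣ + suc ∣ T ∣₂ + ∣ U₂ - j ∣  ≡⟨ cong (_+ ∣ U₂ - j ∣) (+-suc ∣ S₂ ∣ ∣ T ∣₂) ⟩
        suc (∣ S₂ ∣ + ∣ T ∣₂) + ∣ U₂ - j ∣ ≡⟨ +-suc (∣ S₂ ∣ + ∣ T ∣₂) ∣ U₂ - j ∣ ⟨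
        ∣ S₂ ∣ + ∣ T ∣₂ + suc ∣ U₂ - j ∣   ≡⟨ cong (∣ S₂ ∣ + ∣ T ∣₂ +_) (1+∣p-x∣≡∣p∣ j∈U₂) ⟩
        ∣ S₂ ∣ + ∣ T ∣₂ + ∣ U₂ ∣           ≡⟨ size₂ ⟩
        m                                 ∎
    ; disjoint₁  = disjoint₁
    ; disjoint₂  = λ j′∈S₂ → disjoint₂ j′∈S₂ ∘ U₂-j⊆U₂
    ; fresh      = ((λ j∈S₂ → disjoint₂ j∈S₂ j∈U₂) , x∉p-x) ∷ All.map Fresh-push fresh
    ; path       = linked
    ; unique     = All.map (unvisited-fresh {u = inj₂ j} j∈U₂) fresh ∷ unique
    }
    where
    open Invariant I
    open ≡-Reasoning
    U₂-j⊆U₂ : U₂ - j ⊆ U₂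
    U₂-j⊆U₂ = p─q⊆p U₂ ⁅ j ⁆
    Fresh-push : ∀ {v} → Fresh (state S₁ S₂ U₁ U₂ T) v →
                 Fresh (state S₁ S₂ U₁ (U₂ - j) (inj₂ j ∷ T)) v
    Fresh-push {inj₁ _} f                  = f
    Fresh-push {inj₂ _} (j′∉S₂ , j′∉U₂) = j′∉S₂ , j′∉U₂ ∘ U₂-j⊆U₂

  full-stack-top-isolated : ∀ {H S₁ S₂ U₁ U₂ j T} → ¬ Path H k →
                            Invariant H (state S₁ S₂ U₁ U₂ (inj₂ j ∷ T)) → suc (length T) ≡ k →
                            ∀ i → i ∈ U₁ → ¬ BipGraph.E H i j ≡ true
  full-stack-top-isolated np I full i i∈U₁ e = np (subst (Path _) full (Linked∧Unique⇒Path
    (e ∷ path) (All.map (unvisited-fresh {u = inj₁ i} i∈U₁) fresh ∷ unique)))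
    where open Invariant I

  neighbour? : ∀ (H : BipGraph m) i U → Dec (∃[ j ] j ∈ U × BipGraph.E H i j ≡ true)
  neighbour? H i U = any? λ j → (j ∈? U) ×-dec (BipGraph.E H i j ≟ᵇ true)

  stop : ∀ {H st} → Live H st → ∣ S₁ st ∣ ≡ ∣ U₂ st ∣ → LargeBiHole H k
  stop {H} {st} L ∣S₁∣≡∣U₂∣ with m + m ≤? 4 * ∣ S₁ st ∣ + k
  ... | yes large =
    NoEdgesBetween⇒LargeBiHole (Invariant.separated₁ (Live.invariant L)) large
      (subst (λ c → m + m ≤ 4 * c + k) ∣S₁∣≡∣U₂∣ large)
  ... | no small =
    NoEdgesBetween⇒LargeBiHole separated₂
      (remainder-large {∣ S₁ st ∣} {∣ T st ∣₁} {∣ U₁ st ∣} size₁ (proj₁ halves) (≰⇒> small))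
      (remainder-large {∣ S₁ st ∣} {∣ T st ∣₂} {∣ S₂ st ∣} size₂′ (proj₂ halves) (≰⇒> small))
    where
    open Live L
    open Invariant invariant
    halves = sides-≤-half path short
    reverse : ∀ a b c → a + b + c ≡ c + b + a
    reverse = solve-∀
    size₂′ : ∣ S₁ st ∣ + ∣ T st ∣₂ + ∣ S₂ st ∣ ≡ m
    size₂′ = trans (cong (λ u → u + ∣ T st ∣₂ + ∣ S₂ st ∣) ∣S₁∣≡∣U₂∣)
                   (trans (reverse (∣ U₂ st ∣) (∣ T st ∣₂) (∣ S₂ st ∣)) size₂)

  potential : State → ℕ
  potential st = 2 * (∣ U₁ st ∣ + ∣ U₂ st ∣) + length (T st)

  potential-ᵀ : ∀ st → potential (transpose st) ≡ potential st
  potential-ᵀ st = cong₂ _+_ (cong (2 *_) (+-comm ∣ U₂ st ∣ ∣ U₁ st ∣)) (length-map swap (T st))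

  pop-potential : ∀ u l → 2 * u + l < 2 * u + suc l
  pop-potential u l = +-monoʳ-< (2 * u) ≤-refl

  push-potential : ∀ {U₂ : Subset m} {j} u₁ l → j ∈ U₂ →
                   2 * (u₁ + ∣ U₂ - j ∣) + suc l < 2 * (u₁ + ∣ U₂ ∣) + l
  push-potential {U₂} {j} u₁ l j∈U₂ =
    subst (λ u → 2 * (u₁ + ∣ U₂ - j ∣) + suc l < 2 * (u₁ + u) + l) (1+∣p-x∣≡∣p∣ j∈U₂)
      (≤-reflexive (shift u₁ ∣ U₂ - j ∣ l))
    where
    shift : ∀ a b l → suc (2 * (a + b) + suc l) ≡ 2 * (a + suc b) + l
    shift = solve-∀

  run : ∀ fuel {H st} → ¬ Path H k → Live H st → potential st < fuel → LargeBiHole H k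
  advance : ∀ fuel {H st} → ¬ Path H k → Live H st →
            ∣ S₁ st ∣ < ∣ U₂ st ∣ → ∣ S₂ st ∣ < ∣ U₁ st ∣ → potential st < fuel → LargeBiHole H k
  advance₁ : ∀ fuel {H S₁ S₂ U₁ U₂ i T} → ¬ Path H k → Live H (state S₁ S₂ U₁ U₂ (inj₁ i ∷ T)) →
             ∣ S₁ ∣ < ∣ U₂ ∣ → ∣ S₂ ∣ < ∣ U₁ ∣ →
             potential (state S₁ S₂ U₁ U₂ (inj₁ i ∷ T)) ≤ fuel → LargeBiHole H k
  extend : ∀ fuel {H S₁ S₂ U₁ U₂ j T} → ¬ Path H k → Live H (state S₁ S₂ U₁ U₂ T) →
           ∣ S₁ ∣ < ∣ U₂ ∣ → ∣ S₂ ∣ < ∣ U₁ ∣ → j ∈ U₂ → Linked (Adj H) (inj₂ j ∷ T) →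
           potential (state S₁ S₂ U₁ U₂ T) ≤ fuel → LargeBiHole H k

  run fuel {st = st} np L p with ∣ S₁ st ∣ ≟ ∣ U₂ st ∣ | ∣ S₂ st ∣ ≟ ∣ U₁ st ∣
  ... | yes e | _     = stop L e
  ... | no _  | yes e = LargeBiHole-ᵀ (stop (Live-ᵀ L) e)
  ... | no ≢₁ | no ≢₂ =
    advance fuel np L (≤∧≢⇒< (Live.balanced₁ L) ≢₁) (≤∧≢⇒< (Live.balanced₂ L) ≢₂) p

  advance zero _ _ _ _ ()
  advance (suc f) {st = state _ _ _ _ []} np L s₁< s₂< p =
    let j , j∈U₂ = 0<∣p∣⇒Nonempty (≤-<-trans z≤n s₁<)
    in extend f np L s₁< s₂< j∈U₂ [-] (s≤s⁻¹ p)
  advance (suc f) {st = state _ _ _ _ (inj₁ _ ∷ _)} np L s₁< s₂< p =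
    advance₁ f np L s₁< s₂< (s≤s⁻¹ p)
  advance (suc f) {st = st@(state _ _ _ _ (inj₂ _ ∷ _))} np L s₁< s₂< p =
    LargeBiHole-ᵀ (advance₁ f (np ∘ Path-ᵀ) (Live-ᵀ L) s₂< s₁<
      (subst (_≤ f) (sym (potential-ᵀ st)) (s≤s⁻¹ p)))

  advance₁ f {H} {S₁} {S₂} {U₁} {U₂} {i} {T} np L s₁< s₂< p with neighbour? H i U₂
  ... | yes (j , j∈U₂ , e) = extend f np L s₁< s₂< j∈U₂ (e ∷ Invariant.path (Live.invariant L)) p
  ... | no isolated = run f np popped (<-≤-trans (pop-potential (∣ U₁ ∣ + ∣ U₂ ∣) (length T)) p)
    where
    open Live L
    i∉S₁ = proj₁ (All.head (Invariant.fresh invariant))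
    popped : Live H (state (S₁ ∪ ⁅ i ⁆) S₂ U₁ U₂ T)
    popped = record
      { invariant = pop₁ invariant λ j j∈U₂ e → isolated (j , j∈U₂ , e)
      ; short     = ≤-trans (n≤1+n _) short
      ; balanced₁ = subst (_≤ ∣ U₂ ∣) (sym (∣p∪⁅x⁆∣≡1+∣p∣ i∉S₁)) s₁<
      ; balanced₂ = <⇒≤ s₂<
      }

  extend f {H} {S₁} {S₂} {U₁} {U₂} {j} {T} np L s₁< s₂< j∈U₂ linked p =
    settle (m≤n⇒m<n∨m≡n short)
    where
    open Live L
    pushedState = state S₁ S₂ U₁ (U₂ - j) (inj₂ j ∷ T)
    pushed : Invariant H pushedState
    pushed = push₂ invariant j∈U₂ linked
    ∣S₁∣≤∣U₂-j∣ : ∣ S₁ ∣ ≤ ∣ U₂ - j ∣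
    ∣S₁∣≤∣U₂-j∣ = s≤s⁻¹ (subst (suc ∣ S₁ ∣ ≤_) (sym (1+∣p-x∣≡∣p∣ j∈U₂)) s₁<)
    j∉S₂ : j ∉ S₂
    j∉S₂ j∈S₂ = Invariant.disjoint₂ invariant j∈S₂ j∈U₂
    settle : suc (length T) < k ⊎ suc (length T) ≡ k → LargeBiHole H k
    settle (inj₁ room) = run f np
      (record { invariant = pushed ; short = room ; balanced₁ = ∣S₁∣≤∣U₂-j∣ ; balanced₂ = <⇒≤ s₂< })
      (<-≤-trans (push-potential ∣ U₁ ∣ (length T) j∈U₂) p)
    -- j filled the stack, so it has no unvisited neighbour and is finished at once.
    settle (inj₂ full) = LargeBiHole-ᵀ (run f (np ∘ Path-ᵀ)
      (record
        { invariant = pop₁ (Invariant-ᵀ pushed) (full-stack-top-isolated np pushed full)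
        ; short     = subst (_< k) (sym (length-map swap T)) (≤-reflexive full)
        ; balanced₁ = subst (_≤ ∣ U₁ ∣) (sym (∣p∪⁅x⁆∣≡1+∣p∣ j∉S₂)) s₂<
        ; balanced₂ = ∣S₁∣≤∣U₂-j∣
        })
      (begin-strict
        potential (state (S₂ ∪ ⁅ j ⁆) S₁ (U₂ - j) U₁ (map swap T))
          <⟨ pop-potential (∣ U₂ - j ∣ + ∣ U₁ ∣) (length (map swap T)) ⟩
        potential (transpose pushedState) ≡⟨ potential-ᵀ pushedState ⟩
        potential pushedState             <⟨ push-potential ∣ U₁ ∣ (length T) j∈U₂ ⟩
        potential (state S₁ S₂ U₁ U₂ T)   ≤⟨ p ⟩
        f                                 ∎))
      where open ≤-Reasoning

  start : ∀ {H} → 0 < k → Live H (state ∅ ∅ full full [])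
  start 0<k = record
    { invariant = record
      { separated₁ = λ _ _ i∈∅ _ → contradiction i∈∅ ∉⊥
      ; separated₂ = λ _ _ _ j∈∅ → contradiction j∈∅ ∉⊥
      ; size₁      = initial-size
      ; size₂      = initial-size
      ; disjoint₁  = λ i∈∅ → contradiction i∈∅ ∉⊥
      ; disjoint₂  = λ j∈∅ → contradiction j∈∅ ∉⊥
      ; fresh      = []
      ; path       = []
      ; unique     = []
      }
    ; short     = 0<k
    ; balanced₁ = p⊆q⇒∣p∣≤∣q∣ {p = ∅ {m}} {full} ⊥⊆
    ; balanced₂ = p⊆q⇒∣p∣≤∣q∣ {p = ∅ {m}} {full} ⊥⊆
    }
    where
    initial-size : ∣ ∅ {m} ∣ + 0 + ∣ full {m} ∣ ≡ m
    initial-size = cong₂ (λ s u → s + 0 + u) (∣⊥∣≡0 m) (∣⊤∣≡n m)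

  search : ∀ {H} → ¬ Path H k → 0 < k → LargeBiHole H k
  search np 0<k = run _ np (start 0<k) ≤-refl

¬Path⇒LargeBiHole : ∀ {m} (G : BipGraph m) k → ¬ Path G k → LargeBiHole G k
¬Path⇒LargeBiHole {zero}  G zero    _  = ∅ , ∅ , refl , z≤n , λ ()
¬Path⇒LargeBiHole {suc _} G zero    np =
  ⊥-elim (np (Linked∧Unique⇒Path {v = inj₁ zero} [-] ([] ∷ [])))
¬Path⇒LargeBiHole         G (suc k) np = DFS.search (suc k) np (s≤s z≤n)

corollary6p8 : (n m k : ℕ) → n ≡ m + m → (G : BipGraph m) → ¬ Path G k →
    Σ[ X₁ ∈ Subset m ] Σ[ X₂ ∈ Subset m ]
      (∣ X₁ ∣ ≡ ∣ X₂ ∣ × n ≤ 4 * ∣ X₁ ∣ + k × NoEdgesBetween G X₁ X₂)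
corollary6p8 .(m + m) m k refl G np = ¬Path⇒LargeBiHole G k np
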